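{- For any finite simple graph $G$ with at least one edge and any positive integer $p$, $r_p(G)\le\mu_p(G)$, with equality if $r_p(G)=1$.
   Context: For a graph $G=(V,E)$, $N_G(x)$ denotes the neighbourhood of $x$. A set $D\subseteq V$ is a $p$-dominating set if every vertex $x\notin D$ has at least $p$ neighbours in $D$; $\gamma_p(G)$ is the minimum size of a $p$-dominating set, and a $\gamma_p$-set is a $p$-dominating set of that size. For $B\subseteq E(G^c)$ (edges of the complement), $G+B=(V,E\cup B)$. The $p$-reinforcement number is $r_p(G)=\min\{|B| : B\subseteq E(G^c),\ \gamma_p(G+B)<\gamma_p(G)\}$, with the convention $r_p(G)=0$ if $\gamma_p(G)\le p$. For $X\subseteq V$ and $x\in X$, a vertex $y\notin X$ is a $p$-private neighbour of $x$ with respect to $X$ if $xy\in E$ and $|N_G(y)\cap X|=p$; $PN_p(x,X,G)$ is the set of such $y$. Define $\mu_p(x,X,G)=|PN_p(x,X,G)|+\max\{0,p-|N_G(x)\cap X|\}$, $\mu_p(X,G)=\min\{\mu_p(x,X,G): x\in X\}$, and $\mu_p(G)=\min\{\mu_p(X,G) : X \text{ is a } \gamma_p\text{ -set of } G\}$. -}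

module Defs where

open import Data.Bool using (Bool; true; false; _∧_; _∨_)
open import Data.Bool.Properties using (∨-comm)
open import Data.Nat using (ℕ; zero; suc; _+_; _∸_; _≤_; _<_; _<ᵇ_)
open import Data.Fin using (Fin; toℕ)
open import Data.Fin.Subset using (Subset; _∈_; _∉_; _∩_; ∣_∣)
open import Data.List using (List; map; allFin)
open import Data.Nat.ListAction using (sum)
open import Data.Vec using (tabulate)
open import Data.Product using (Σ; ∃; ∃-syntax; _×_; _,_)
open import Relation.Binary.PropositionalEquality using (_≡_; refl; cong₂)

record Graph (n : ℕ) : Set where
  field
    adj    : Fin n → Fin n → Bool
    sym    : ∀ i j → adj i j ≡ adj j i
    irrefl : ∀ i → adj i i ≡ false
open Graph public

HasEdge : ∀ {n} → Graph n → Set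
HasEdge G = ∃[ i ] ∃[ j ] adj G i j ≡ true

N : ∀ {n} → Graph n → Fin n → Subset n
N G x = tabulate (adj G x)

numEdges : ∀ {n} → Graph n → ℕ
numEdges {n} G = sum (map (λ i → ∣ tabulate (λ j → adj G i j ∧ (toℕ i <ᵇ toℕ j)) ∣) (allFin n))

-- B ⊆ E(G^c): B is a simple graph on the same vertices whose edges are non-edges of G
InComplement : ∀ {n} → Graph n → Graph n → Set
InComplement G B = ∀ i j → adj B i j ≡ true → adj G i j ≡ false

_⊕_ : ∀ {n} → Graph n → Graph n → Graph n
G ⊕ B = record
  { adj    = λ i j → adj G i j ∨ adj B i j
  ; sym    = λ i j → cong₂ _∨_ (sym G i j) (sym B i j)
  ; irrefl = λ i → helper (irrefl G i) (irrefl B i) }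
  where
  helper : ∀ {a b} → a ≡ false → b ≡ false → (a ∨ b) ≡ false
  helper refl refl = refl

IsPDom : ∀ {n} → Graph n → ℕ → Subset n → Set
IsPDom G p D = ∀ x → x ∉ D → p ≤ ∣ N G x ∩ D ∣

IsMin : (ℕ → Set) → ℕ → Set
IsMin P k = P k × (∀ j → P j → k ≤ j)

IsGamma : ∀ {n} → Graph n → ℕ → ℕ → Set
IsGamma G p = IsMin (λ k → ∃[ D ] (IsPDom G p D × ∣ D ∣ ≡ k))

IsGammaSet : ∀ {n} → Graph n → ℕ → Subset n → Set
IsGammaSet G p X = IsPDom G p X × IsGamma G p ∣ X ∣

-- r = r_p(G) (with the convention r_p(G) = 0 if γ_p(G) ≤ p)
ReinfSize : ∀ {n} → Graph n → ℕ → ℕ → Set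
ReinfSize G p k = ∃[ B ] (InComplement G B × numEdges B ≡ k ×
  ∃[ g ] ∃[ g' ] (IsGamma G p g × IsGamma (G ⊕ B) p g' × g' < g))

IsRp : ∀ {n} → Graph n → ℕ → ℕ → Set
IsRp G p r = ∀ g → IsGamma G p g →
  (g ≤ p → r ≡ 0) × (p < g → IsMin (ReinfSize G p) r)

PN : ∀ {n} → Graph n → ℕ → Fin n → Subset n → Subset n
PN G p x X = tabulate (λ y → (adj G x y ∧ notIn y) ∧ eqᵇ ∣ N G y ∩ X ∣ p)
  where
  open import Data.Vec using (lookup)
  open import Data.Bool using (not)
  open import Data.Nat using () renaming (_≡ᵇ_ to eqᵇ)
  notIn : Fin _ → Bool
  notIn y = not (lookup X y)

μx : ∀ {n} → Graph n → ℕ → Fin n → Subset n → ℕ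
μx G p x X = ∣ PN G p x X ∣ + (p ∸ ∣ N G x ∩ X ∣)

IsMu : ∀ {n} → Graph n → ℕ → ℕ → Set
IsMu G p = IsMin (λ k → ∃[ X ] (IsGammaSet G p X × ∃[ x ] (x ∈ X × μx G p x X ≡ k)))

module Submission where

-- Theorem 5.1: for a graph G and p ≥ 1,  r_p(G) ≤ μ_p(G),  and  r_p(G) = μ_p(G)  when  r_p(G) = 1.
--
-- Let X be a γ_p-set with γ_p(G) > p, and x ∈ X.  In  X′ = X ∖ {x}  every vertex
-- outside X′ lacks at most  need v  neighbours, where  need v = 1  for p-private neighbours of x
-- and  need x = p − |N(x) ∩ X|.  Since |X′| ≥ p, X′ contains at least  need v  non-neighbours of
-- v; joining v to that many of them (module Reinforcement) makes X′ p-dominating, using at most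
-- Σ need = μ_p(x,X,G) new edges.  Hence γ_p drops and r_p(G) ≤ μ_p(x,X,G).  (If γ_p(G) ≤ p then
-- r_p(G) = 0 by convention.)
--
-- Equality for r_p = 1.  If adding one edge lowers γ_p, take a γ_p-set D of G + B.  Some v ∉ D
-- has fewer than p G-neighbours in D, so the new edge joins v to some u ∈ D.  Then D ∪ {v} is a
-- γ_p-set of G in which v has no p-private neighbours and at least p − 1 neighbours, so
-- μ_p(G) ≤ 1 (module SingleEdge).

open import Defs renaming (sym to adj-sym)
import Algebra.Properties.CommutativeMonoid.Sum as CommutativeMonoidSum
open import Data.Bool using (Bool; true; false; _∧_; _∨_; not; if_then_else_; T)
import Data.Bool as Bool
open import Data.Bool.Properties
  using (∧-assoc; ∧-comm; ∧-zeroʳ; ∧-identityʳ; ∨-comm; ∨-zeroʳ; ∨-identityʳ; ∧-distribʳ-∨; not-injective)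
open import Data.Fin using (Fin; zero; suc; toℕ)
open import Data.Fin.Properties using (_≟_; suc-injective; toℕ-injective; all?; ¬∀⟶∃¬)
open import Data.Fin.Subset using (Subset; _∈_; _∉_; _∩_; ∣_∣)
open import Data.Fin.Subset.Properties using (_∈?_; anySubset?)
import Data.List as List using (tabulate)
open import Data.List.Properties using (map-tabulate)
open import Data.Nat.ListAction using () renaming (sum to listSum)
open import Data.Nat using (ℕ; zero; suc; _+_; _∸_; _⊓_; _≤_; _<_; _≤?_; _<ᵇ_; _≡ᵇ_; z≤n; s≤s)
import Data.Nat as ℕ
open import Data.Nat.Induction using (<-rec)
open import Data.Nat.Properties hiding (suc-injective; _≟_)
open import Data.Product using (∃-syntax; _×_; _,_; proj₁; proj₂)
open import Data.Sum using (_⊎_; inj₁; inj₂)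
open import Data.Vec using ([]; _∷_; tabulate; lookup)
open import Data.Vec.Properties using (lookup∘tabulate; tabulate∘lookup; lookup-zipWith; []=⇒lookup; lookup⇒[]=)
open import Function using (_∘_)
open import Relation.Binary.Definitions using (tri<; tri≈; tri>)
open import Relation.Binary.PropositionalEquality
open import Relation.Nullary using (¬_; Dec; yes; no; does; contradiction)
open import Relation.Nullary.Decidable using (_×-dec_; _→-dec_; ¬?; dec-true; dec-false)
open import Relation.Unary using (Decidable)

open CommutativeMonoidSum +-0-commutativeMonoid
  using (sum; sum-syntax; sum-cong-≗; sum-replicate-zero; ∑-distrib-+; ∑-comm)

sum-mono : ∀ {n} {f g : Fin n → ℕ} → (∀ i → f i ≤ g i) → sum f ≤ sum g
sum-mono {zero}  _ = z≤n
sum-mono {suc n} h = +-mono-≤ (h zero) (sum-mono (h ∘ suc))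

sum-zero : ∀ {n} {f : Fin n → ℕ} → (∀ i → f i ≡ 0) → sum f ≡ 0
sum-zero {n} h = trans (sum-cong-≗ h) (sum-replicate-zero n)

sum-point : ∀ {n} (f : Fin n → ℕ) a → (∀ i → i ≢ a → f i ≡ 0) → sum f ≡ f a
sum-point f zero    h = trans (cong (f zero +_) (sum-zero (λ i → h (suc i) λ ()))) (+-identityʳ _)
sum-point f (suc a) h =
  cong₂ _+_ (h zero λ ()) (sum-point (f ∘ suc) a (λ i i≢a → h (suc i) (i≢a ∘ suc-injective)))

entry≤sum : ∀ {n} (f : Fin n → ℕ) a → f a ≤ sum f
entry≤sum f zero    = m≤m+n _ _
entry≤sum f (suc a) = ≤-trans (entry≤sum (f ∘ suc) a) (m≤n+m _ _)

two-entries≤sum : ∀ {n} (f : Fin n → ℕ) {a c} → a ≢ c → f a + f c ≤ sum f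
two-entries≤sum f {zero}  {zero}  a≢c = contradiction refl a≢c
two-entries≤sum f {zero}  {suc c} _   = +-monoʳ-≤ (f zero) (entry≤sum (f ∘ suc) c)
two-entries≤sum f {suc a} {zero}  _   =
  subst (_≤ sum f) (+-comm (f zero) _) (+-monoʳ-≤ (f zero) (entry≤sum (f ∘ suc) a))
two-entries≤sum f {suc a} {suc c} a≢c =
  ≤-trans (two-entries≤sum (f ∘ suc) (a≢c ∘ cong suc)) (m≤n+m _ _)

∑² : ∀ {n} → (Fin n → Fin n → ℕ) → ℕ
∑² {n} f = ∑[ i < n ] ∑[ j < n ] f i j

∑²-mono : ∀ {n} {f g : Fin n → Fin n → ℕ} → (∀ i j → f i j ≤ g i j) → ∑² f ≤ ∑² g
∑²-mono h = sum-mono (λ i → sum-mono (h i))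

∑²-distrib-+ : ∀ {n} (f g : Fin n → Fin n → ℕ) → ∑² (λ i j → f i j + g i j) ≡ ∑² f + ∑² g
∑²-distrib-+ f g = trans (sum-cong-≗ (λ i → ∑-distrib-+ (f i) (g i))) (∑-distrib-+ (sum ∘ f) (sum ∘ g))

two-cells≤∑² : ∀ {n} (f : Fin n → Fin n → ℕ) {a b c d} → ¬ (a ≡ c × b ≡ d) → f a b + f c d ≤ ∑² f
two-cells≤∑² f {a} {b} {c} {d} different with a ≟ c
... | no a≢c   = ≤-trans (+-mono-≤ (entry≤sum (f a) b) (entry≤sum (f c) d))
                         (two-entries≤sum (λ i → sum (f i)) a≢c)
... | yes refl = ≤-trans (two-entries≤sum (f a) (λ b≡d → different (refl , b≡d)))
                         (entry≤sum (λ i → sum (f i)) a)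

∧-true : ∀ {a b} → (a ∧ b) ≡ true → a ≡ true × b ≡ true
∧-true {true} {true} _ = refl , refl

∨-false : ∀ {a b} → (a ∨ b) ≡ false → a ≡ false × b ≡ false
∨-false {false} {false} _ = refl , refl

T⇒≡true : ∀ {b} → T b → b ≡ true
T⇒≡true {true} _ = refl

≡ᵇ-false : ∀ m n → m ≢ n → (m ≡ᵇ n) ≡ false
≡ᵇ-false m n m≢n with m ≡ᵇ n in e
... | true  = contradiction (≡ᵇ⇒≡ m n (subst T (sym e) _)) m≢n
... | false = refl

<ᵇ-asym : ∀ m n → ((m <ᵇ n) ∧ (n <ᵇ m)) ≡ false
<ᵇ-asym zero    zero    = refl
<ᵇ-asym zero    (suc n) = refl
<ᵇ-asym (suc m) zero    = refl
<ᵇ-asym (suc m) (suc n) = <ᵇ-asym m n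

_==_ : ∀ {n} → Fin n → Fin n → Bool
i == j = does (i ≟ j)

==-refl : ∀ {n} (a : Fin n) → (a == a) ≡ true
==-refl a = dec-true (a ≟ a) refl

==-false : ∀ {n} {i j : Fin n} → i ≢ j → (i == j) ≡ false
==-false {i = i} {j} = dec-false (i ≟ j)

==-false⇒≢ : ∀ {n} {i j : Fin n} → (i == j) ≡ false → i ≢ j
==-false⇒≢ {i = i} e refl = contradiction (trans (sym (==-refl i)) e) λ ()

ind : Bool → ℕ
ind false = 0
ind true  = 1

count : ∀ {n} → (Fin n → Bool) → ℕ
count {n} b = ∑[ i < n ] ind (b i)

_⊆ᵇ_ : ∀ {n} → (Fin n → Bool) → (Fin n → Bool) → Set
b ⊆ᵇ c = ∀ i → b i ≡ true → c i ≡ true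

count-cong : ∀ {n} {b c : Fin n → Bool} → (∀ i → b i ≡ c i) → count b ≡ count c
count-cong h = sum-cong-≗ (cong ind ∘ h)

count-mono : ∀ {n} {b c : Fin n → Bool} → b ⊆ᵇ c → count b ≤ count c
count-mono {b = b} {c} h = sum-mono pointwise
  where
  pointwise : ∀ i → ind (b i) ≤ ind (c i)
  pointwise i with b i | h i
  ... | false | _    = z≤n
  ... | true  | b⇒c rewrite b⇒c refl = ≤-refl

count-false : ∀ {n} {b : Fin n → Bool} → (∀ i → b i ≡ false) → count b ≡ 0
count-false h = sum-zero (cong ind ∘ h)

count-point : ∀ {n} (b : Fin n → Bool) a → (∀ i → i ≢ a → b i ≡ false) → count b ≡ ind (b a)
count-point b a h = sum-point (ind ∘ b) a (λ i i≢a → cong ind (h i i≢a))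

count-singleton : ∀ {n} (a : Fin n) → count (_== a) ≡ 1
count-singleton a = trans (count-point (_== a) a (λ _ → ==-false)) (cong ind (==-refl a))

count-∨-disjoint : ∀ {n} (b c : Fin n → Bool) → (∀ i → (b i ∧ c i) ≡ false) →
  count (λ i → b i ∨ c i) ≡ count b + count c
count-∨-disjoint b c disjoint = trans (sum-cong-≗ pointwise) (∑-distrib-+ (ind ∘ b) (ind ∘ c))
  where
  pointwise : ∀ i → ind (b i ∨ c i) ≡ ind (b i) + ind (c i)
  pointwise i with b i | c i | disjoint i
  ... | true  | false | _ = refl
  ... | false | _     | _ = refl

count-split : ∀ {n} (b c : Fin n → Bool) →
  count b ≡ count (λ i → b i ∧ c i) + count (λ i → b i ∧ not (c i))
count-split b c =
  trans (sum-cong-≗ pointwise) (∑-distrib-+ (λ i → ind (b i ∧ c i)) (λ i → ind (b i ∧ not (c i))))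
  where
  pointwise : ∀ i → ind (b i) ≡ ind (b i ∧ c i) + ind (b i ∧ not (c i))
  pointwise i with b i | c i
  ... | false | _     = refl
  ... | true  | true  = refl
  ... | true  | false = refl

count-without : ∀ {n} (b : Fin n → Bool) a → count b ≡ count (λ j → b j ∧ not (j == a)) + ind (b a)
count-without b a = begin
  count b            ≡⟨ count-split b (_== a) ⟩
  at + rest          ≡⟨ +-comm at rest ⟩
  rest + at          ≡⟨ cong (rest +_) at-a ⟩
  rest + ind (b a)   ∎
  where
  open ≡-Reasoning
  at rest : ℕ
  at   = count (λ j → b j ∧ (j == a))
  rest = count (λ j → b j ∧ not (j == a))
  at-a : count (λ j → b j ∧ (j == a)) ≡ ind (b a)
  at-a = trans (count-point _ a (λ i i≢a → trans (cong (b i ∧_) (==-false i≢a)) (∧-zeroʳ _)))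
               (cong ind (trans (cong (b a ∧_) (==-refl a)) (∧-identityʳ _)))

count-pos : ∀ {n} (b : Fin n → Bool) → 0 < count b → ∃[ i ] b i ≡ true
count-pos {suc n} b pos with b zero in e
... | true  = zero , e
... | false with count-pos (b ∘ suc) pos
...   | i , bi = suc i , bi

-- take k b: the first k elements of b (all of them if b has fewer).
take : ∀ {n} → ℕ → (Fin n → Bool) → Fin n → Bool
take zero    b i       = false
take (suc k) b zero    = b zero
take (suc k) b (suc i) = take (if b zero then k else suc k) (b ∘ suc) i

take-⊆ : ∀ {n} k (b : Fin n → Bool) → take k b ⊆ᵇ b
take-⊆ (suc k) b zero    e = e
take-⊆ (suc k) b (suc i) e = take-⊆ (if b zero then k else suc k) (b ∘ suc) i e

count-take : ∀ {n} k (b : Fin n → Bool) → count (take k b) ≡ k ⊓ count b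
count-take {zero}  k       b = sym (⊓-zeroʳ k)
count-take {suc n} zero    b = count-false {b = take zero b} (λ _ → refl)
count-take {suc n} (suc k) b with b zero
... | true  = cong suc (count-take k (b ∘ suc))
... | false = count-take (suc k) (b ∘ suc)

least-witness : (P : ℕ → Set) → Decidable P → ∀ k → P k → ∃[ m ] (IsMin P m × m ≤ k)
least-witness P P? = <-rec (λ k → P k → ∃[ m ] (IsMin P m × m ≤ k)) search
  where
  search : ∀ k → (∀ {j} → j < k → P j → ∃[ m ] (IsMin P m × m ≤ j)) →
           P k → ∃[ m ] (IsMin P m × m ≤ k)
  search k below pk with anyUpTo? P? k
  ... | yes (j , j<k , pj) with below j<k pj
  ...   | m , min , m≤j = m , min , ≤-trans m≤j (<⇒≤ j<k)
  search k below pk | no none = k , (pk , λ j pj → ≮⇒≥ (λ j<k → none (j , j<k , pj))) , ≤-refl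

card-lookup : ∀ {n} (D : Subset n) → ∣ D ∣ ≡ count (lookup D)
card-lookup []          = refl
card-lookup (true ∷ D)  = cong suc (card-lookup D)
card-lookup (false ∷ D) = card-lookup D

card-tabulate : ∀ {n} (b : Fin n → Bool) → ∣ tabulate b ∣ ≡ count b
card-tabulate b = trans (card-lookup (tabulate b)) (count-cong (lookup∘tabulate b))

∈⇒lookup : ∀ {n} {v : Fin n} {D : Subset n} → v ∈ D → lookup D v ≡ true
∈⇒lookup = []=⇒lookup

∉⇒lookup : ∀ {n} {v : Fin n} {D : Subset n} → v ∉ D → lookup D v ≡ false
∉⇒lookup {v = v} {D} v∉D with lookup D v in e
... | true  = contradiction (lookup⇒[]= v D e) v∉D
... | false = refl

lookup⇒∉ : ∀ {n} {v : Fin n} {D : Subset n} → lookup D v ≡ false → v ∉ D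
lookup⇒∉ e v∈D with trans (sym e) (∈⇒lookup v∈D)
... | ()

deg : ∀ {n} → Graph n → Fin n → (Fin n → Bool) → ℕ
deg H v b = count (λ j → adj H v j ∧ b j)

deg-lookup : ∀ {n} (H : Graph n) v (D : Subset n) → ∣ N H v ∩ D ∣ ≡ deg H v (lookup D)
deg-lookup H v D = trans (card-lookup (N H v ∩ D)) (count-cong λ j →
  trans (lookup-zipWith _∧_ j (N H v) D) (cong (_∧ lookup D j) (lookup∘tabulate (adj H v) j)))

deg-tabulate : ∀ {n} (H : Graph n) v (b : Fin n → Bool) → ∣ N H v ∩ tabulate b ∣ ≡ deg H v b
deg-tabulate H v b = trans (deg-lookup H v (tabulate b))
  (count-cong (λ j → cong (adj H v j ∧_) (lookup∘tabulate b j)))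

Dominates : ∀ {n} → Graph n → ℕ → (Fin n → Bool) → Set
Dominates H p b = ∀ v → b v ≡ false → p ≤ deg H v b

pdom⇒dominates : ∀ {n} (H : Graph n) p (D : Subset n) → IsPDom H p D → Dominates H p (lookup D)
pdom⇒dominates H p D dom v Dv = subst (p ≤_) (deg-lookup H v D) (dom v (lookup⇒∉ Dv))

dominates⇒pdom : ∀ {n} (H : Graph n) p (b : Fin n → Bool) → Dominates H p b → IsPDom H p (tabulate b)
dominates⇒pdom H p b dom v v∉ =
  subst (p ≤_) (sym (deg-tabulate H v b)) (dom v (trans (sym (lookup∘tabulate b v)) (∉⇒lookup v∉)))

deficient-vertex : ∀ {n} (H : Graph n) p (b : Fin n → Bool) →
  ¬ Dominates H p b → ∃[ v ] (b v ≡ false × deg H v b < p)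
deficient-vertex {n} H p b not-dom
  with ¬∀⟶∃¬ n _ (λ v → (b v Bool.≟ false) →-dec (p ≤? deg H v b)) not-dom
... | v , fails with b v in bv
...   | true  = contradiction (λ ()) fails
...   | false = v , bv , ≰⇒> (λ p≤ → fails (λ _ → p≤))

gamma-exists : ∀ {n} (H : Graph n) p (D : Subset n) → IsPDom H p D → ∃[ g ] (IsGamma H p g × g ≤ ∣ D ∣)
gamma-exists H p D dom = least-witness _ has-pdom-of-size ∣ D ∣ (D , dom , refl)
  where
  pdom? : ∀ E → Dec (IsPDom H p E)
  pdom? E = all? (λ v → ¬? (v ∈? E) →-dec (p ≤? ∣ N H v ∩ E ∣))
  has-pdom-of-size : ∀ k → Dec (∃[ E ] (IsPDom H p E × ∣ E ∣ ≡ k))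
  has-pdom-of-size k = anySubset? (λ E → pdom? E ×-dec (∣ E ∣ ℕ.≟ k))

privNbrs : ∀ {n} → Graph n → ℕ → Fin n → (Fin n → Bool) → Fin n → Bool
privNbrs G p x b y = (adj G x y ∧ not (b y)) ∧ (deg G y b ≡ᵇ p)

μx-tabulate : ∀ {n} (G : Graph n) p x (b : Fin n → Bool) →
  μx G p x (tabulate b) ≡ count (privNbrs G p x b) + (p ∸ deg G x b)
μx-tabulate G p x b = cong₂ _+_
  (trans (card-tabulate (λ y → (adj G x y ∧ not (lookup (tabulate b) y)) ∧ (∣ N G y ∩ tabulate b ∣ ≡ᵇ p)))
         (count-cong λ y →
    cong₂ (λ a d → (adj G x y ∧ not a) ∧ (d ≡ᵇ p)) (lookup∘tabulate b y) (deg-tabulate G y b)))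
  (cong (p ∸_) (deg-tabulate G x b))

deg-⊕ : ∀ {n} (G B : Graph n) → InComplement G B → ∀ v b → deg (G ⊕ B) v b ≡ deg G v b + deg B v b
deg-⊕ G B B⊆Gᶜ v b =
  trans (count-cong (λ j → ∧-distribʳ-∨ (b j) (adj G v j) (adj B v j)))
        (count-∨-disjoint (λ j → adj G v j ∧ b j) (λ j → adj B v j ∧ b j) disjoint)
  where
  disjoint : ∀ j → ((adj G v j ∧ b j) ∧ (adj B v j ∧ b j)) ≡ false
  disjoint j with adj B v j in e
  ... | false = ∧-zeroʳ _
  ... | true rewrite B⊆Gᶜ v j e = refl

deg-without : ∀ {n} (H : Graph n) v (b : Fin n → Bool) a →
  deg H v b ≡ deg H v (λ j → b j ∧ not (j == a)) + ind (adj H v a ∧ b a)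
deg-without H v b a = trans (count-without (λ j → adj H v j ∧ b j) a)
  (cong (_+ ind (adj H v a ∧ b a)) (count-cong (λ j → ∧-assoc (adj H v j) (b j) _)))

sum-list-tabulate : ∀ {n} (f : Fin n → ℕ) → listSum (List.tabulate f) ≡ sum f
sum-list-tabulate {zero}  f = refl
sum-list-tabulate {suc n} f = cong (f zero +_) (sum-list-tabulate (f ∘ suc))

lt : ∀ {n} → Fin n → Fin n → Bool
lt i j = toℕ i <ᵇ toℕ j

numEdges-∑ : ∀ {n} (H : Graph n) → numEdges H ≡ ∑² (λ i j → ind (adj H i j ∧ lt i j))
numEdges-∑ {n} H =
  trans (cong listSum (map-tabulate (λ i → i) row))
  (trans (sum-list-tabulate row) (sum-cong-≗ (λ i → card-tabulate (λ j → adj H i j ∧ lt i j))))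
  where
  row : Fin n → ℕ
  row i = ∣ tabulate (λ j → adj H i j ∧ lt i j) ∣

symmetrise : ∀ {n} (O : Fin n → Fin n → Bool) → (∀ i → O i i ≡ false) → Graph n
symmetrise O loopless = record
  { adj    = λ i j → O i j ∨ O j i
  ; sym    = λ i j → ∨-comm (O i j) (O j i)
  ; irrefl = λ i → cong₂ _∨_ (loopless i) (loopless i)
  }

numEdges-symmetrise : ∀ {n} (O : Fin n → Fin n → Bool) (loopless : ∀ i → O i i ≡ false) →
  numEdges (symmetrise O loopless) ≤ ∑[ i < n ] count (O i)
numEdges-symmetrise {n} O loopless = begin
  numEdges (symmetrise O loopless)            ≡⟨ numEdges-∑ (symmetrise O loopless) ⟩
  ∑² (λ i j → ind ((O i j ∨ O j i) ∧ lt i j)) ≤⟨ ∑²-mono (λ i j → split (O i j) (O j i) (lt i j)) ⟩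
  ∑² (λ i j → forward i j + backward i j)     ≡⟨ ∑²-distrib-+ forward backward ⟩
  ∑² forward + ∑² backward                    ≡⟨ cong (∑² forward +_) (∑-comm backward) ⟩
  ∑² forward + ∑² (λ i j → backward j i)      ≡⟨ sym (∑²-distrib-+ forward (λ i j → backward j i)) ⟩
  ∑² (λ i j → forward i j + backward j i)     ≤⟨ ∑²-mono (λ i j → one-direction (O i j) (<ᵇ-asym (toℕ i) (toℕ j))) ⟩
  ∑² (λ i j → ind (O i j))                    ∎
  where
  open ≤-Reasoning
  forward backward : Fin n → Fin n → ℕ
  forward  i j = ind (O i j ∧ lt i j)
  backward i j = ind (O j i ∧ lt i j)
  split : ∀ a b l → ind ((a ∨ b) ∧ l) ≤ ind (a ∧ l) + ind (b ∧ l)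
  split true  b l = m≤m+n _ _
  split false b l = ≤-refl
  one-direction : ∀ a {l r} → (l ∧ r) ≡ false → ind (a ∧ l) + ind (a ∧ r) ≤ ind a
  one-direction false         _ = z≤n
  one-direction true {true}  {false} _ = ≤-refl
  one-direction true {false} {false} _ = z≤n
  one-direction true {false} {true}  _ = ≤-refl

oriented : ∀ {n} (H : Graph n) {a b} → adj H a b ≡ true →
  (adj H a b ∧ lt a b) ≡ true ⊎ (adj H b a ∧ lt b a) ≡ true
oriented H {a} {b} e with <-cmp (toℕ a) (toℕ b)
... | tri< a<b _ _ = inj₁ (cong₂ _∧_ e (T⇒≡true (<⇒<ᵇ a<b)))
... | tri> _ _ b<a = inj₂ (cong₂ _∧_ (trans (adj-sym H b a) e) (T⇒≡true (<⇒<ᵇ b<a)))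
... | tri≈ _ a≡b _ with toℕ-injective a≡b
...   | refl = contradiction (trans (sym e) (irrefl H a)) λ ()

oriented-unique : ∀ {n} (H : Graph n) → numEdges H ≤ 1 → ∀ {a b c d} →
  (adj H a b ∧ lt a b) ≡ true → (adj H c d ∧ lt c d) ≡ true → a ≡ c × b ≡ d
oriented-unique H one {a} {b} {c} {d} e₁ e₂ with (a ≟ c) ×-dec (b ≟ d)
... | yes same     = same
... | no different = contradiction (subst (_≤ 1) (numEdges-∑ H) one) (<⇒≱ two-edges)
  where
  two-edges : 2 ≤ ∑² (λ i j → ind (adj H i j ∧ lt i j))
  two-edges = ≤-trans (≤-reflexive (cong₂ (λ s t → ind s + ind t) (sym e₁) (sym e₂)))
                      (two-cells≤∑² _ different)

single-edge : ∀ {n} (H : Graph n) → numEdges H ≤ 1 → ∀ {a b c d} →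
  adj H a b ≡ true → adj H c d ≡ true → (a ≡ c × b ≡ d) ⊎ (a ≡ d × b ≡ c)
single-edge H one e₁ e₂ with oriented H e₁ | oriented H e₂
... | inj₁ o₁ | inj₁ o₂ = inj₁ (oriented-unique H one o₁ o₂)
... | inj₁ o₁ | inj₂ o₂ = inj₂ (oriented-unique H one o₁ o₂)
... | inj₂ o₁ | inj₁ o₂ = let b≡c , a≡d = oriented-unique H one o₁ o₂ in inj₂ (a≡d , b≡c)
... | inj₂ o₁ | inj₂ o₂ = let b≡d , a≡c = oriented-unique H one o₁ o₂ in inj₁ (a≡c , b≡d)

module Reinforcement {n} (G : Graph n) (p : ℕ) (X : Fin n → Bool) (x : Fin n)
  (X-dom : Dominates G p X) (x∈X : X x ≡ true) (p<∣X∣ : p < count X) where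

  -- X′ = X ∖ {x}, the candidate smaller p-dominating set of G + B.
  X′ : Fin n → Bool
  X′ j = X j ∧ not (j == x)

  ∣X′∣ : count X ≡ suc (count X′)
  ∣X′∣ = trans (count-without X x) (trans (cong (λ c → count X′ + ind c) x∈X) (+-comm (count X′) 1))

  p≤∣X′∣ : p ≤ count X′
  p≤∣X′∣ = ≤-pred (subst (p <_) ∣X′∣ p<∣X∣)

  deg-X′ : ∀ v → deg G v X ≡ deg G v X′ + ind (adj G v x)
  deg-X′ v = trans (deg-without G v X x)
    (cong (λ c → deg G v X′ + ind c) (trans (cong (adj G v x ∧_) x∈X) (∧-identityʳ _)))

  ∉X′⇒∉X : ∀ v → X′ v ≡ false → v ≢ x → X v ≡ false
  ∉X′⇒∉X v e v≢x =
    trans (sym (∧-identityʳ (X v))) (trans (cong (λ c → X v ∧ not c) (sym (==-false v≢x))) e)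

  private-nbr : Fin n → Bool
  private-nbr = privNbrs G p x X

  private-nbr⇒ : ∀ v → private-nbr v ≡ true → adj G v x ≡ true × deg G v X ≡ p
  private-nbr⇒ v e with ∧-true {adj G x v ∧ not (X v)} e
  ... | xv , deg≡p = trans (adj-sym G v x) (proj₁ (∧-true xv)) , ≡ᵇ⇒≡ _ p (subst T (sym deg≡p) _)

  -- How many new X′-neighbours v needs: one for a p-private neighbour of x, p − |N(x) ∩ X| for x.
  need : Fin n → ℕ
  need v = ind (private-nbr v) + (if v == x then p ∸ deg G x X else 0)

  need-x : need x ≡ p ∸ deg G x X′
  need-x = trans (cong₂ (λ a c → ind ((a ∧ not (X x)) ∧ (deg G x X ≡ᵇ p)) + (if c then p ∸ deg G x X else 0))
                        (irrefl G x) (==-refl x))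
                 (cong (p ∸_) deg-x)
    where
    deg-x : deg G x X ≡ deg G x X′
    deg-x = trans (deg-X′ x) (trans (cong (λ c → deg G x X′ + ind c) (irrefl G x)) (+-identityʳ _))

  need-other : ∀ v → v ≢ x → need v ≡ ind (private-nbr v)
  need-other v v≢x = trans (cong (λ c → ind (private-nbr v) + (if c then p ∸ deg G x X else 0)) (==-false v≢x))
                           (+-identityʳ _)

  ∑need : ∑[ v < n ] need v ≡ count private-nbr + (p ∸ deg G x X)
  ∑need = trans (∑-distrib-+ (ind ∘ private-nbr) (λ v → if v == x then p ∸ deg G x X else 0))
    (cong (count private-nbr +_)
    (trans (sum-point _ x (λ i i≢x → cong (λ c → if c then p ∸ deg G x X else 0) (==-false i≢x)))
           (cong (λ c → if c then p ∸ deg G x X else 0) (==-refl x))))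

  outside-X : ∀ v → X v ≡ false → p ≤ deg G v X′ + ind (private-nbr v)
  outside-X v Xv = by-adjacency (adj G v x) refl
    where
    p≤ : p ≤ deg G v X′ + ind (adj G v x)
    p≤ = subst (p ≤_) (deg-X′ v) (X-dom v Xv)
    by-adjacency : ∀ a → adj G v x ≡ a → p ≤ deg G v X′ + ind (private-nbr v)
    by-adjacency false vx = ≤-trans (subst (λ a → p ≤ deg G v X′ + ind a) vx p≤) (+-monoʳ-≤ _ z≤n)
    by-adjacency true  vx with deg G v X ℕ.≟ p
    ... | yes deg≡p = subst (λ c → p ≤ deg G v X′ + ind c) (sym is-private)
                            (subst (λ a → p ≤ deg G v X′ + ind a) vx p≤)
      where
      is-private : private-nbr v ≡ true
      is-private = trans (cong₂ (λ a c → (a ∧ not c) ∧ (deg G v X ≡ᵇ p)) (trans (adj-sym G x v) vx) Xv)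
                         (T⇒≡true (≡⇒≡ᵇ _ p deg≡p))
    ... | no deg≢p = ≤-trans (m<1+n⇒m≤n p<deg+1) (m≤m+n _ _)
      where
      deg+1 : deg G v X ≡ suc (deg G v X′)
      deg+1 = trans (deg-X′ v) (trans (cong (λ a → deg G v X′ + ind a) vx) (+-comm (deg G v X′) 1))
      p<deg+1 : p < suc (deg G v X′)
      p<deg+1 = subst (p <_) deg+1 (≤∧≢⇒< (X-dom v Xv) (deg≢p ∘ sym))

  deficit≤need : ∀ v → X′ v ≡ false → p ≤ deg G v X′ + need v
  deficit≤need v X′v = cases (v ≟ x)
    where
    cases : Dec (v ≡ x) → p ≤ deg G v X′ + need v
    cases (yes refl) = subst (λ k → p ≤ deg G x X′ + k) (sym need-x) (m≤n+m∸n p (deg G x X′))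
    cases (no v≢x)   = subst (λ k → p ≤ deg G v X′ + k) (sym (need-other v v≢x))
                             (outside-X v (∉X′⇒∉X v X′v v≢x))

  non-nbr : Fin n → Fin n → Bool
  non-nbr v j = X′ j ∧ not (adj G v j)

  ∣X′∣-split : ∀ v → count X′ ≡ deg G v X′ + count (non-nbr v)
  ∣X′∣-split v = trans (count-split X′ (adj G v))
    (cong (_+ count (non-nbr v)) (count-cong (λ j → ∧-comm (X′ j) (adj G v j))))

  private-supply : ∀ v → ind (private-nbr v) ≤ count (non-nbr v)
  private-supply v with private-nbr v in pv
  ... | false = z≤n
  ... | true with private-nbr⇒ v pv
  ...   | vx , deg≡p = +-cancelˡ-≤ (deg G v X′) 1 _ (begin
    deg G v X′ + 1                 ≡⟨ cong (λ c → deg G v X′ + ind c) (sym vx) ⟩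
    deg G v X′ + ind (adj G v x)   ≡⟨ sym (deg-X′ v) ⟩
    deg G v X                      ≡⟨ deg≡p ⟩
    p                              ≤⟨ p≤∣X′∣ ⟩
    count X′                       ≡⟨ ∣X′∣-split v ⟩
    deg G v X′ + count (non-nbr v) ∎)
    where open ≤-Reasoning

  need≤supply : ∀ v → need v ≤ count (non-nbr v)
  need≤supply v = cases (v ≟ x)
    where
    cases : Dec (v ≡ x) → need v ≤ count (non-nbr v)
    cases (yes refl) = subst (_≤ count (non-nbr x)) (sym need-x)
                         (subst (p ∸ deg G x X′ ≤_) supply (∸-monoˡ-≤ (deg G x X′) p≤∣X′∣))
      where
      supply : count X′ ∸ deg G x X′ ≡ count (non-nbr x)
      supply = trans (cong (_∸ deg G x X′) (∣X′∣-split x)) (m+n∸m≡n (deg G x X′) (count (non-nbr x)))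
    cases (no v≢x)   = subst (_≤ count (non-nbr v)) (sym (need-other v v≢x)) (private-supply v)

  O : Fin n → Fin n → Bool
  O v j = not (X′ v) ∧ take (need v) (non-nbr v) j

  O⇒ : ∀ v j → O v j ≡ true → X′ v ≡ false × non-nbr v j ≡ true
  O⇒ v j e with ∧-true {not (X′ v)} e
  ... | nX′v , t = not-injective nX′v , take-⊆ (need v) (non-nbr v) j t

  O-loopless : ∀ v → O v v ≡ false
  O-loopless v with O v v in e
  ... | false = refl
  ... | true with O⇒ v v e
  ...   | X′v , nn = contradiction (trans (sym X′v) (proj₁ (∧-true nn))) λ ()

  O-nonedge : ∀ v j → O v j ≡ true → adj G v j ≡ false
  O-nonedge v j e = not-injective (proj₂ (∧-true (proj₂ (O⇒ v j e))))

  B : Graph n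
  B = symmetrise O O-loopless

  B⊆Gᶜ : InComplement G B
  B⊆Gᶜ i j e with O i j in o
  ... | true  = O-nonedge i j o
  ... | false = trans (adj-sym G i j) (O-nonedge j i e)

  B-size : numEdges B ≤ count private-nbr + (p ∸ deg G x X)
  B-size = ≤-trans (numEdges-symmetrise O O-loopless) (≤-trans (sum-mono O-row) (≤-reflexive ∑need))
    where
    O-row : ∀ v → count (O v) ≤ need v
    O-row v = ≤-trans (count-mono {b = O v} {c = take (need v) (non-nbr v)}
                                  (λ j e → proj₂ (∧-true {not (X′ v)} e)))
                      (≤-trans (≤-reflexive (count-take (need v) (non-nbr v))) (m⊓n≤m (need v) (count (non-nbr v))))

  B-supplies : ∀ v → X′ v ≡ false → need v ≤ deg B v X′
  B-supplies v X′v = begin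
    need v                                   ≡⟨ sym (m≤n⇒m⊓n≡m (need≤supply v)) ⟩
    need v ⊓ count (non-nbr v)               ≡⟨ sym (count-take (need v) (non-nbr v)) ⟩
    count (take (need v) (non-nbr v))        ≡⟨ count-cong (λ j → cong (λ c → not c ∧ take (need v) (non-nbr v) j) (sym X′v)) ⟩
    count (O v)                              ≤⟨ count-mono O-in-B ⟩
    deg B v X′                               ∎
    where
    open ≤-Reasoning
    O-in-B : ∀ j → O v j ≡ true → ((O v j ∨ O j v) ∧ X′ j) ≡ true
    O-in-B j e rewrite e = proj₁ (∧-true (proj₂ (O⇒ v j e)))

  X′-dominates : Dominates (G ⊕ B) p X′
  X′-dominates v X′v = begin
    p                         ≤⟨ deficit≤need v X′v ⟩
    deg G v X′ + need v       ≤⟨ +-monoʳ-≤ (deg G v X′) (B-supplies v X′v) ⟩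
    deg G v X′ + deg B v X′   ≡⟨ sym (deg-⊕ G B B⊆Gᶜ v X′) ⟩
    deg (G ⊕ B) v X′          ∎
    where open ≤-Reasoning

reinforcement-bound : ∀ {n} (G : Graph n) p (X : Subset n) → IsPDom G p X → ∀ x → x ∈ X → p < ∣ X ∣ →
  ∃[ B ] (InComplement G B × numEdges B ≤ μx G p x X × ∃[ g′ ] (IsGamma (G ⊕ B) p g′ × g′ < ∣ X ∣))
reinforcement-bound G p X X-dom x x∈X p<∣X∣ = B , B⊆Gᶜ , size , smaller-gamma
  where
  open Reinforcement G p (lookup X) x (pdom⇒dominates G p X X-dom) (∈⇒lookup x∈X)
                     (subst (p <_) (card-lookup X) p<∣X∣)
  size : numEdges B ≤ μx G p x X
  size = subst (numEdges B ≤_) (sym (trans (cong (μx G p x) (sym (tabulate∘lookup X))) (μx-tabulate G p x (lookup X))))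
               B-size
  smaller-gamma : ∃[ g′ ] (IsGamma (G ⊕ B) p g′ × g′ < ∣ X ∣)
  smaller-gamma with gamma-exists (G ⊕ B) p (tabulate X′) (dominates⇒pdom (G ⊕ B) p X′ X′-dominates)
  ... | g′ , γ′ , g′≤ = g′ , γ′ , subst (g′ <_) (sym (trans (card-lookup X) ∣X′∣))
                                        (s≤s (subst (g′ ≤_) (card-tabulate X′) g′≤))

module SingleEdge {n} (G B : Graph n) (p : ℕ) (B⊆Gᶜ : InComplement G B) (one-edge : numEdges B ≤ 1)
  (D : Fin n → Bool) (D-dom : Dominates (G ⊕ B) p D)
  (v : Fin n) (v∉D : D v ≡ false) (v-short : deg G v D < p) where

  deg⊕ : ∀ w → deg (G ⊕ B) w D ≡ deg G w D + deg B w D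
  deg⊕ w = deg-⊕ G B B⊆Gᶜ w D

  B-gain : 0 < deg B v D
  B-gain = ≰⇒> λ none → <⇒≱ v-short (begin
    p                       ≤⟨ D-dom v v∉D ⟩
    deg (G ⊕ B) v D         ≡⟨ deg⊕ v ⟩
    deg G v D + deg B v D   ≤⟨ +-monoʳ-≤ (deg G v D) none ⟩
    deg G v D + 0           ≡⟨ +-identityʳ (deg G v D) ⟩
    deg G v D               ∎)
    where open ≤-Reasoning

  B-edge : ∃[ u ] (adj B v u ∧ D u) ≡ true
  B-edge = count-pos (λ j → adj B v j ∧ D j) B-gain

  u : Fin n
  u = proj₁ B-edge

  Bvu : adj B v u ≡ true
  Bvu = proj₁ (∧-true (proj₂ B-edge))

  u∈D : D u ≡ true
  u∈D = proj₂ (∧-true (proj₂ B-edge))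

  no-B-nbrs : ∀ w → w ≢ v → D w ≡ false → deg B w D ≡ 0
  no-B-nbrs w w≢v Dw = count-false none
    where
    none : ∀ j → (adj B w j ∧ D j) ≡ false
    none j with adj B w j in e
    ... | false = refl
    ... | true with single-edge B one-edge Bvu e
    ...   | inj₁ (v≡w , _) = contradiction (sym v≡w) w≢v
    ...   | inj₂ (_ , u≡w) = contradiction (trans (sym u∈D) (trans (cong D u≡w) Dw)) λ ()

  one-B-nbr : deg B v D ≤ 1
  one-B-nbr = ≤-trans (count-mono only-u) (≤-reflexive (count-singleton u))
    where
    only-u : ∀ j → (adj B v j ∧ D j) ≡ true → (j == u) ≡ true
    only-u j e with ∧-true {adj B v j} e
    ... | Bvj , Dj with single-edge B one-edge Bvu Bvj
    ...   | inj₁ (_ , u≡j)     = trans (cong (j ==_) u≡j) (==-refl j)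
    ...   | inj₂ (_ , u≡v)     = contradiction (trans (sym u∈D) (trans (cong D u≡v) v∉D)) λ ()

  -- X₂ = D ∪ {v}, which will be a γ_p-set of G.
  X₂ : Fin n → Bool
  X₂ j = D j ∨ (j == v)

  X₂-v : X₂ v ≡ true
  X₂-v = trans (cong (D v ∨_) (==-refl v)) (∨-zeroʳ _)

  X₂-without-v : ∀ j → (X₂ j ∧ not (j == v)) ≡ D j
  X₂-without-v j with j ≟ v
  ... | yes refl = trans (∧-zeroʳ _) (sym v∉D)
  ... | no _     = trans (∧-identityʳ _) (∨-identityʳ _)

  ∣X₂∣ : count X₂ ≡ suc (count D)
  ∣X₂∣ = trans (count-without X₂ v)
    (trans (cong₂ (λ k c → k + ind c) (count-cong X₂-without-v) X₂-v) (+-comm (count D) 1))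

  deg-X₂ : ∀ w → deg G w X₂ ≡ deg G w D + ind (adj G w v)
  deg-X₂ w = trans (deg-without G w X₂ v)
    (cong₂ (λ k c → k + ind c) (count-cong (λ j → cong (adj G w j ∧_) (X₂-without-v j)))
                               (trans (cong (adj G w v ∧_) X₂-v) (∧-identityʳ _)))

  outside-X₂ : ∀ w → X₂ w ≡ false → p ≤ deg G w D
  outside-X₂ w X₂w = begin
    p                       ≤⟨ D-dom w Dw ⟩
    deg (G ⊕ B) w D         ≡⟨ deg⊕ w ⟩
    deg G w D + deg B w D   ≡⟨ cong (deg G w D +_) (no-B-nbrs w w≢v Dw) ⟩
    deg G w D + 0           ≡⟨ +-identityʳ (deg G w D) ⟩
    deg G w D               ∎
    where
    open ≤-Reasoning
    Dw : D w ≡ false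
    Dw = proj₁ (∨-false X₂w)
    w≢v : w ≢ v
    w≢v = ==-false⇒≢ (proj₂ (∨-false {D w} X₂w))

  X₂-dominates : Dominates G p X₂
  X₂-dominates w X₂w = ≤-trans (outside-X₂ w X₂w)
    (subst (deg G w D ≤_) (sym (deg-X₂ w)) (m≤m+n (deg G w D) (ind (adj G w v))))

  -- A G-neighbour of v outside X₂ has more than p neighbours in X₂.
  no-private-nbrs : count (privNbrs G p v X₂) ≡ 0
  no-private-nbrs = count-false not-private
    where
    not-private : ∀ w → ((adj G v w ∧ not (X₂ w)) ∧ (deg G w X₂ ≡ᵇ p)) ≡ false
    not-private w with adj G v w in vw | X₂ w in X₂w
    ... | false | _     = refl
    ... | true  | true  = refl
    ... | true  | false = ≡ᵇ-false (deg G w X₂) p (>⇒≢ (begin-strict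
      p                              ≤⟨ outside-X₂ w X₂w ⟩
      deg G w D                      <⟨ n<1+n (deg G w D) ⟩
      suc (deg G w D)                ≡⟨ +-comm 1 (deg G w D) ⟩
      deg G w D + 1                  ≡⟨ cong (λ c → deg G w D + ind c) (sym (trans (adj-sym G w v) vw)) ⟩
      deg G w D + ind (adj G w v)    ≡⟨ sym (deg-X₂ w) ⟩
      deg G w X₂                     ∎))
      where open ≤-Reasoning

  deg-X₂-v : deg G v X₂ ≡ deg G v D
  deg-X₂-v = trans (deg-X₂ v) (trans (cong (λ c → deg G v D + ind c) (irrefl G v)) (+-identityʳ (deg G v D)))

  deficit-v : p ∸ deg G v X₂ ≤ 1
  deficit-v = m≤n+o⇒m∸n≤o p (deg G v X₂) (begin
    p                          ≤⟨ D-dom v v∉D ⟩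
    deg (G ⊕ B) v D            ≡⟨ deg⊕ v ⟩
    deg G v D + deg B v D      ≤⟨ +-monoʳ-≤ (deg G v D) one-B-nbr ⟩
    deg G v D + 1              ≡⟨ cong (_+ 1) (sym deg-X₂-v) ⟩
    deg G v X₂ + 1             ∎)
    where open ≤-Reasoning

  μ-v : count (privNbrs G p v X₂) + (p ∸ deg G v X₂) ≤ 1
  μ-v = subst (λ k → k + (p ∸ deg G v X₂) ≤ 1) (sym no-private-nbrs) deficit-v

single-edge-reinforcement : ∀ {n} (G B : Graph n) p → InComplement G B → numEdges B ≤ 1 →
  ∀ {g g′} → IsGamma G p g → IsGamma (G ⊕ B) p g′ → g′ < g →
  ∃[ X ] (IsGammaSet G p X × ∃[ v ] (v ∈ X × μx G p v X ≤ 1))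
single-edge-reinforcement {n} G B p B⊆Gᶜ one-edge {g} γ ((D₀ , D₀-dom , ∣D₀∣≡g′) , _) g′<g =
  build (deficient-vertex G p D D-not-dominating)
  where
  D : Fin n → Bool
  D = lookup D₀
  D-not-dominating : ¬ Dominates G p D
  D-not-dominating dom = <⇒≱ (subst (_< g) (trans (sym ∣D₀∣≡g′) (card-lookup D₀)) g′<g)
    (subst (g ≤_) (card-tabulate D) (proj₂ γ _ (tabulate D , dominates⇒pdom G p D dom , refl)))
  build : ∃[ v ] (D v ≡ false × deg G v D < p) →
          ∃[ X ] (IsGammaSet G p X × ∃[ v ] (v ∈ X × μx G p v X ≤ 1))
  build (v , v∉D , v-short) =
    tabulate X₂ , (dominates⇒pdom G p X₂ X₂-dominates , X₂-gamma) , v ,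
    lookup⇒[]= v (tabulate X₂) (trans (lookup∘tabulate X₂ v) X₂-v) ,
    subst (_≤ 1) (sym (μx-tabulate G p v X₂)) μ-v
    where
    open SingleEdge G B p B⊆Gᶜ one-edge D (pdom⇒dominates (G ⊕ B) p D₀ D₀-dom) v v∉D v-short
    X₂-witness : ∃[ E ] (IsPDom G p E × ∣ E ∣ ≡ ∣ tabulate X₂ ∣)
    X₂-witness = tabulate X₂ , dominates⇒pdom G p X₂ X₂-dominates , refl
    ∣X₂∣≡g : count X₂ ≡ g
    ∣X₂∣≡g = ≤-antisym (subst (_≤ g) (sym (trans ∣X₂∣ (cong suc (trans (sym (card-lookup D₀)) ∣D₀∣≡g′)))) g′<g)
                       (subst (g ≤_) (card-tabulate X₂) (proj₂ γ _ X₂-witness))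
    X₂-gamma : IsGamma G p ∣ tabulate X₂ ∣
    X₂-gamma = subst (IsGamma G p) (sym (trans (card-tabulate X₂) ∣X₂∣≡g)) γ

rp≤μx : ∀ {n} (G : Graph n) p {r} (X : Subset n) x → IsRp G p r → IsGammaSet G p X → x ∈ X → r ≤ μx G p x X
rp≤μx G p X x isRp (X-dom , X-γ) x∈X with ∣ X ∣ ≤? p | isRp ∣ X ∣ X-γ
... | yes γ≤p | small , _ = subst (_≤ _) (sym (small γ≤p)) z≤n
... | no γ≰p  | _ , large with reinforcement-bound G p X X-dom x x∈X (≰⇒> γ≰p)
...   | B , B⊆Gᶜ , B≤μ , g′ , γ′ , g′<γ =
        ≤-trans (proj₂ (large (≰⇒> γ≰p)) _ (B , B⊆Gᶜ , refl , _ , g′ , X-γ , γ′ , g′<γ)) B≤μ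

rp≡1⇒small-μ : ∀ {n} (G : Graph n) p {r g} → IsRp G p r → IsGamma G p g → r ≡ 1 →
  ∃[ X ] (IsGammaSet G p X × ∃[ v ] (v ∈ X × μx G p v X ≤ 1))
rp≡1⇒small-μ G p {g = g} isRp γ refl with g ≤? p | isRp g γ
... | yes γ≤p | small , _ = contradiction (small γ≤p) λ ()
... | no γ≰p  | _ , large with proj₁ (large (≰⇒> γ≰p))
...   | B , B⊆Gᶜ , one-edge , _ , _ , γ₁ , γ′ , g′<g₁ =
        single-edge-reinforcement G B p B⊆Gᶜ (≤-reflexive one-edge) γ₁ γ′ g′<g₁

theorem5p1 : ∀ {n} (G : Graph n) (p : ℕ) → 1 ≤ p → HasEdge G →
    ∀ r m → IsRp G p r → IsMu G p m → r ≤ m × (r ≡ 1 → r ≡ m)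
theorem5p1 G p _ _ r m isRp ((X , X-γset , x , x∈X , μ≡m) , m-least) = r≤m , r≡1⇒r≡m
  where
  r≤m : r ≤ m
  r≤m = subst (r ≤_) μ≡m (rp≤μx G p X x isRp X-γset x∈X)
  r≡1⇒r≡m : r ≡ 1 → r ≡ m
  r≡1⇒r≡m r≡1 with rp≡1⇒small-μ G p isRp (proj₂ X-γset) r≡1
  ... | X₂ , X₂-γset , v , v∈X₂ , μ≤1 =
        ≤-antisym r≤m (subst (m ≤_) (sym r≡1) (≤-trans (m-least _ (X₂ , X₂-γset , v , v∈X₂ , refl)) μ≤1))
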